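{- Every finite simple graph $G$ with maximum degree at most $3$ admits a $2$-labelling $\ell$ such that, for every $x \geq 1$, the subgraph of $G$ induced by $S_x = \{v \in V(G) : \rho_\ell(v) = x\}$ is a forest.
   Context: A $2$-labelling of a graph $G$ is a map $\ell: E(G) \to \{1,2\}$. For a vertex $v$, $\rho_\ell(v)$ denotes the product of the labels $\ell(uv)$ over all edges $uv$ incident to $v$ (the empty product being $1$). -}

module Defs where

open import Data.Nat using (ℕ; _≤_; _*_)
open import Data.Bool using (Bool; true; false; if_then_else_)
open import Data.Fin using (Fin)
open import Data.List using (List; []; _∷_; _++_; [_]; length; map; filter)
open import Data.Nat.ListAction using (product)
open import Data.List.Relation.Unary.Linked using (Linked)
open import Data.List.Relation.Unary.Unique.Propositional using (Unique)
open import Data.Vec.Functional using (toList)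
open import Data.Product using (_×_; Σ)
open import Relation.Binary.PropositionalEquality using (_≡_)
open import Relation.Nullary using (¬_)
open import Data.Bool using (T)

record Graph (n : ℕ) : Set where
  field
    adj    : Fin n → Fin n → Bool
    sym    : ∀ u v → adj u v ≡ adj v u
    irrefl : ∀ v → adj v v ≡ false
open Graph public

vertices : ∀ {n} → List (Fin n)
vertices {n} = toList (λ i → i)

Adj : ∀ {n} → Graph n → Fin n → Fin n → Set
Adj G u v = T (adj G u v)

degree : ∀ {n} → Graph n → Fin n → ℕ
degree G v = length (Data.List.filter (λ u → Data.Bool._≟_ (adj G v u) true) vertices)

MaxDegreeAtMost : ∀ {n} → Graph n → ℕ → Set
MaxDegreeAtMost G d = ∀ v → degree G v ≤ d

data Label : Set where
  one two : Label

val : Label → ℕ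
val one = 1
val two = 2

-- a 2-labelling: a label for every (unordered) edge, represented as a
-- symmetric function on ordered pairs (values on non-edges are irrelevant)
record TwoLabelling {n : ℕ} (G : Graph n) : Set where
  field
    lab     : Fin n → Fin n → Label
    lab-sym : ∀ u v → lab u v ≡ lab v u
open TwoLabelling public

ρ : ∀ {n} {G : Graph n} → TwoLabelling G → Fin n → ℕ
ρ {G = G} ℓ v = product (map (λ u → if adj G v u then val (lab ℓ v u) else 1) vertices)

IsCycle : ∀ {n} → Graph n → List (Fin n) → Set
IsCycle G [] = Data.Empty.⊥ where import Data.Empty
IsCycle G (v ∷ vs) =
  Unique (v ∷ vs) × (3 ≤ length (v ∷ vs)) × Linked (Adj G) ((v ∷ vs) ++ [ v ])

-- the subgraph induced by S ⊆ V(G) is a forest: no cycle of G lies inside S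
-- (cycles of the induced subgraph are exactly cycles of G with all vertices in S)
open import Data.List.Relation.Unary.All using (All)

InducedForest : ∀ {n} → Graph n → (Fin n → Set) → Set
InducedForest {n} G S = ∀ (c : List (Fin n)) → IsCycle G c → ¬ All S c

-- ρ_ℓ(v) = 2 ^ t(v), where t(v) is the number of edges at v labelled 2, so the sets S_x are
-- the level sets of t. Starting from the all-1 labelling, toggle one edge label at a time so
-- that the potential 4 M + Σ_v π(t(v)) decreases, where M counts the monochromatic edges
-- (edges inside a level set) once per direction and π = 3, 2, 0, 1 on levels 0, 1, 2, 3.
-- While some level set contains a non-backtracking walk p a u b r — and every cycle inside a
-- level set contains one — a case analysis on the labels of ua and ub yields an edge at u
-- whose toggle decreases the potential: toggling an edge moves both ends by one level in the
-- same direction, so only edges from the ends to other vertices change colour, and maximum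
-- degree 3 leaves too little room for new monochromatic edges to appear.
module Submission where

open import Data.Bool using (Bool; true; false; T; not; _∧_; _∨_; if_then_else_)
import Data.Bool as Bool
open import Data.Bool.Properties
  using (∧-comm; ∧-identityʳ; ∧-zeroʳ; ∨-comm; ∨-identityʳ; ∨-zeroʳ; T-≡; T-∧; T-not-≡)
open import Data.Empty using (⊥; ⊥-elim)
open import Data.Fin using (Fin; zero; suc)
import Data.Fin.Properties as Fin
open import Data.List using ([]; _∷_; _++_; [_]; length; tabulate; filter; map)
open import Data.List.Membership.Propositional using (_∈_)
open import Data.List.Properties using (map-tabulate; tabulate-cong)
open import Data.List.Relation.Unary.All as All using (All; []; _∷_)
open import Data.List.Relation.Unary.All.Properties using (++⁺)
open import Data.List.Relation.Unary.AllPairs using ([]; _∷_)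
open import Data.List.Relation.Unary.Any using (here; there)
open import Data.List.Relation.Unary.Linked using (Linked; _∷_)
open import Data.List.Relation.Unary.Unique.Propositional using (Unique)
open import Data.Nat using (ℕ; zero; suc; _+_; _*_; _^_; _≤_; _<_; _≤?_; _≡ᵇ_; z≤n; s≤s)
open import Data.Nat.Induction using (<-wellFounded)
open import Data.Nat.ListAction using (product)
open import Data.Nat.Logarithm using (⌊log₂_⌋; ⌊log₂[2^n]⌋≡n)
open import Data.Nat.Properties
open import Data.Nat.Tactic.RingSolver using (solve-∀)
open import Data.Product using (Σ; _×_; _,_; ∃; proj₁; proj₂)
open import Data.Sum using (_⊎_; inj₁; inj₂; [_,_]′)
open import Function using (_∘_; id)
open import Function.Bundles using (Equivalence; _⇔_; mk⇔)
open import Induction.WellFounded using (Acc; acc)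
open import Relation.Binary.PropositionalEquality
  using (_≡_; _≢_; refl; sym; trans; cong; cong₂; subst; subst₂; module ≡-Reasoning)
open import Relation.Nullary using (¬_; ¬?; Dec; yes; no; does; contradiction)
open import Relation.Nullary.Decidable using (T?; map′; _×-dec_; dec-true; dec-false; does-⇔)

open import Algebra.Properties.CommutativeMonoid.Sum +-0-commutativeMonoid
  using (sum; sum-cong-≗; ∑-distrib-+; sum-replicate-zero)
open import Defs hiding (sym)
open Equivalence using (to; from)

sum-mono-≤ : ∀ {n} {f g : Fin n → ℕ} → (∀ i → f i ≤ g i) → sum f ≤ sum g
sum-mono-≤ {zero}  _   = z≤n
sum-mono-≤ {suc n} f≤g = +-mono-≤ (f≤g zero) (sum-mono-≤ (f≤g ∘ suc))

sum-exchange : ∀ {n} {f g : Fin n → ℕ} c → (∀ i → i ≢ c → f i ≡ g i) → sum f + g c ≡ sum g + f c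
sum-exchange {suc n} {f} {g} zero f≡g = begin
  f zero + sum (f ∘ suc) + g zero  ≡⟨ cong (λ s → f zero + s + g zero) (sum-cong-≗ (λ i → f≡g (suc i) λ ())) ⟩
  f zero + sum (g ∘ suc) + g zero  ≡⟨ swap-outer (f zero) (sum (g ∘ suc)) (g zero) ⟩
  g zero + sum (g ∘ suc) + f zero  ∎
  where
  open ≡-Reasoning
  swap-outer : ∀ a s b → a + s + b ≡ b + s + a
  swap-outer = solve-∀
sum-exchange {suc n} {f} {g} (suc c) f≡g = begin
  f zero + sum (f ∘ suc) + g (suc c)    ≡⟨ +-assoc (f zero) _ _ ⟩
  f zero + (sum (f ∘ suc) + g (suc c))
    ≡⟨ cong₂ _+_ (f≡g zero λ ()) (sum-exchange c λ i i≢c → f≡g (suc i) (i≢c ∘ Fin.suc-injective)) ⟩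
  g zero + (sum (g ∘ suc) + f (suc c))  ≡⟨ +-assoc (g zero) _ _ ⟨
  g zero + sum (g ∘ suc) + f (suc c)    ∎
  where open ≡-Reasoning

sum-exchange₂ : ∀ {n} {f g : Fin n → ℕ} {x y} → x ≢ y →
  (∀ i → i ≢ x → i ≢ y → f i ≡ g i) → sum f + (g x + g y) ≡ sum g + (f x + f y)
sum-exchange₂ {n} {f} {g} {x} {y} x≢y f≡g = begin
  sum f + (g x + g y)  ≡⟨ +-assoc (sum f) _ _ ⟨
  sum f + g x + g y    ≡⟨ cong (λ z → sum f + z + g y) (h≡g x x≢y) ⟨
  sum f + h x + g y    ≡⟨ cong (_+ g y) (sum-exchange x f≡h) ⟩
  sum h + f x + g y    ≡⟨ +-assoc (sum h) _ _ ⟩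
  sum h + (f x + g y)  ≡⟨ cong (sum h +_) (+-comm (f x) (g y)) ⟩
  sum h + (g y + f x)  ≡⟨ +-assoc (sum h) _ _ ⟨
  sum h + g y + f x    ≡⟨ cong (_+ f x) (sum-exchange y h≡g) ⟩
  sum g + h y + f x    ≡⟨ cong (λ z → sum g + z + f x) (f≡h y (x≢y ∘ sym)) ⟨
  sum g + f y + f x    ≡⟨ +-assoc (sum g) _ _ ⟩
  sum g + (f y + f x)  ≡⟨ cong (sum g +_) (+-comm (f y) (f x)) ⟩
  sum g + (f x + f y)  ∎
  where
  open ≡-Reasoning
  h : Fin n → ℕ
  h i with i Fin.≟ x
  ... | yes _ = g i
  ... | no  _ = f i
  f≡h : ∀ i → i ≢ x → f i ≡ h i
  f≡h i i≢x with i Fin.≟ x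
  ... | yes i≡x = ⊥-elim (i≢x i≡x)
  ... | no  _   = refl
  h≡g : ∀ i → i ≢ y → h i ≡ g i
  h≡g i i≢y with i Fin.≟ x
  ... | yes _   = refl
  ... | no  i≢x = f≡g i i≢x i≢y

total : ∀ {n} → (Fin n → Fin n → ℕ) → ℕ
total t = sum (sum ∘ t)

-- Only rows and columns x and y change, and by symmetry each column sum is the matching row
-- sum, whence the factor 2.
total-exchange : ∀ {n} {t t′ : Fin n → Fin n → ℕ} {x y} → x ≢ y →
  (∀ a b → t a b ≡ t b a) → (∀ a b → t′ a b ≡ t′ b a) → (∀ a → t a a ≡ 0) → (∀ a → t′ a a ≡ 0) →
  (∀ a b → a ≢ x → a ≢ y → b ≢ x → b ≢ y → t′ a b ≡ t a b) → t′ x y ≡ t x y →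
  total t′ + 2 * (sum (t x) + sum (t y)) ≡ total t + 2 * (sum (t′ x) + sum (t′ y))
total-exchange {n} {t} {t′} {x} {y} x≢y t-sym t′-sym t-diag t′-diag t′≡t t′xy =
  +-cancelʳ-≡ (2 * s) _ _ (begin
    total t′ + 2 * (sum (t x) + sum (t y)) + 2 * s
      ≡⟨ regroup (total t′) (sum (t x)) (sum (t y)) s ⟩
    total t′ + (sum (t x) + sum (t y)) + ((sum (t x) + (0 + s)) + (sum (t y) + (s + 0)))
      ≡⟨ cong₂ _+_ (sum-by-columns t′ t t-sym) (cong₂ _+_ Rx Ry) ⟨
    sum L + (R x + R y)
      ≡⟨ sum-exchange₂ x≢y inner ⟩
    sum R + (L x + L y)
      ≡⟨ cong₂ _+_ (sum-by-columns t t′ t′-sym) (cong₂ _+_ Lx Ly) ⟩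
    total t + (sum (t′ x) + sum (t′ y)) + ((sum (t′ x) + (0 + s)) + (sum (t′ y) + (s + 0)))
      ≡⟨ regroup (total t) (sum (t′ x)) (sum (t′ y)) s ⟨
    total t + 2 * (sum (t′ x) + sum (t′ y)) + 2 * s ∎)
  where
  open ≡-Reasoning
  s : ℕ
  s = t x y
  L R : Fin n → ℕ
  L a = sum (t′ a) + (t a x + t a y)
  R a = sum (t a) + (t′ a x + t′ a y)
  inner : ∀ a → a ≢ x → a ≢ y → L a ≡ R a
  inner a a≢x a≢y = sum-exchange₂ x≢y (λ b → t′≡t a b a≢x a≢y)
  sum-by-columns : ∀ (u v : Fin n → Fin n → ℕ) → (∀ a b → v a b ≡ v b a) →
    sum (λ a → sum (u a) + (v a x + v a y)) ≡ total u + (sum (v x) + sum (v y))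
  sum-by-columns u v v-sym = begin
    sum (λ a → sum (u a) + (v a x + v a y))            ≡⟨ ∑-distrib-+ (sum ∘ u) _ ⟩
    total u + sum (λ a → v a x + v a y)                ≡⟨ cong (total u +_) (∑-distrib-+ (λ a → v a x) _) ⟩
    total u + (sum (λ a → v a x) + sum (λ a → v a y))
      ≡⟨ cong (total u +_) (cong₂ _+_ (sum-cong-≗ (λ a → v-sym a x)) (sum-cong-≗ (λ a → v-sym a y))) ⟩
    total u + (sum (v x) + sum (v y))                  ∎
  Rx : R x ≡ sum (t x) + (0 + s)
  Rx = cong (sum (t x) +_) (cong₂ _+_ (t′-diag x) t′xy)
  Ry : R y ≡ sum (t y) + (s + 0)
  Ry = cong (sum (t y) +_) (cong₂ _+_ (trans (t′-sym y x) t′xy) (t′-diag y))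
  Lx : L x ≡ sum (t′ x) + (0 + s)
  Lx = cong (sum (t′ x) +_) (cong (_+ s) (t-diag x))
  Ly : L y ≡ sum (t′ y) + (s + 0)
  Ly = cong (sum (t′ y) +_) (cong₂ _+_ (t-sym y x) (t-diag y))
  regroup : ∀ m a b c → m + 2 * (a + b) + 2 * c ≡ m + (a + b) + ((a + (0 + c)) + (b + (c + 0)))
  regroup = solve-∀

χ : Bool → ℕ
χ true  = 1
χ false = 0

count : ∀ {n} → (Fin n → Bool) → ℕ
count P = sum (χ ∘ P)

addPoint : ∀ {n} → (Fin n → Bool) → Fin n → Fin n → Bool
addPoint P x i = P i ∨ does (i Fin.≟ x)

∧-congˡ : ∀ {p q r} → (T p → q ≡ r) → p ∧ q ≡ p ∧ r
∧-congˡ {false} _   = refl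
∧-congˡ {true}  q≡r = q≡r _

χ-false : ∀ {p} → ¬ T p → χ p ≡ 0
χ-false {false} _  = refl
χ-false {true}  ¬p = ⊥-elim (¬p _)

χ-mono : ∀ {p q} → (T p → T q) → χ p ≤ χ q
χ-mono {false}         _   = z≤n
χ-mono {true} {true}   _   = ≤-refl
χ-mono {true} {false} p⇒q = ⊥-elim (p⇒q _)

χ-disjoint : ∀ {p q r} → (T p → T q → ⊥) → (T p → T r) → (T q → T r) → χ p + χ q ≤ χ r
χ-disjoint {true}  {true}  disj _   _   = ⊥-elim (disj _ _)
χ-disjoint {true}  {false} _    p⇒r _   = χ-mono p⇒r
χ-disjoint {false} {q}     _    _   q⇒r = χ-mono q⇒r

module _ {n : ℕ} {P Q : Fin n → Bool} where

  count-mono : (∀ i → T (P i) → T (Q i)) → count P ≤ count Q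
  count-mono P⇒Q = sum-mono-≤ (λ i → χ-mono (P⇒Q i))

  count-disjoint : {R : Fin n → Bool} → (∀ i → T (P i) → T (Q i) → ⊥) →
    (∀ i → T (P i) → T (R i)) → (∀ i → T (Q i) → T (R i)) → count P + count Q ≤ count R
  count-disjoint {R} disj P⇒R Q⇒R = begin
    count P + count Q              ≡⟨ ∑-distrib-+ (χ ∘ P) (χ ∘ Q) ⟨
    sum (λ i → χ (P i) + χ (Q i))  ≤⟨ sum-mono-≤ (λ i → χ-disjoint (disj i) (P⇒R i) (Q⇒R i)) ⟩
    count R                        ∎
    where open ≤-Reasoning

count-none : ∀ {n} {P : Fin n → Bool} → (∀ i → ¬ T (P i)) → count P ≡ 0
count-none {n} ¬P = trans (sum-cong-≗ (χ-false ∘ ¬P)) (sum-replicate-zero n)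

count-addPoint : ∀ {n} {P : Fin n → Bool} {x} → ¬ T (P x) → count (addPoint P x) ≡ suc (count P)
count-addPoint {n} {P} {x} ¬Px = begin
  count (addPoint P x)                ≡⟨ +-identityʳ _ ⟨
  count (addPoint P x) + 0            ≡⟨ cong (count (addPoint P x) +_) (χ-false ¬Px) ⟨
  count (addPoint P x) + χ (P x)      ≡⟨ sum-exchange x agree ⟨
  count P + χ (addPoint P x x)        ≡⟨ cong (λ b → count P + χ (P x ∨ b)) (dec-true (x Fin.≟ x) refl) ⟩
  count P + χ (P x ∨ true)            ≡⟨ cong (λ b → count P + χ b) (∨-zeroʳ (P x)) ⟩
  count P + 1                         ≡⟨ +-comm (count P) 1 ⟩
  suc (count P)                       ∎
  where
  open ≡-Reasoning
  agree : ∀ i → i ≢ x → χ (P i) ≡ χ (addPoint P x i)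
  agree i i≢x = cong χ (sym (trans (cong (P i ∨_) (dec-false (i Fin.≟ x) i≢x)) (∨-identityʳ (P i))))

addPoint⇒ : ∀ {n} {P : Fin n → Bool} {x i} → T (addPoint P x i) → T (P i) ⊎ i ≡ x
addPoint⇒ {P = P} {x} {i} Pi with i Fin.≟ x
... | yes i≡x = inj₂ i≡x
... | no  _   = inj₁ (subst T (∨-identityʳ (P i)) Pi)

count-extend : ∀ {n} {P Q : Fin n → Bool} {xs} → (∀ i → T (P i) → T (Q i)) → Unique xs →
  All (λ i → ¬ T (P i) × T (Q i)) xs → count P + length xs ≤ count Q
count-extend {xs = []} P⇒Q _ _ = ≤-trans (≤-reflexive (+-identityʳ _)) (count-mono P⇒Q)
count-extend {n} {P} {Q} {x ∷ xs} P⇒Q (x∉xs ∷ unique) ((¬Px , Qx) ∷ new) = begin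
  count P + suc (length xs)         ≡⟨ +-suc (count P) (length xs) ⟩
  suc (count P) + length xs         ≡⟨ cong (_+ length xs) (count-addPoint {P = P} ¬Px) ⟨
  count (addPoint P x) + length xs  ≤⟨ count-extend P′⇒Q unique (All.zipWith fresh (x∉xs , new)) ⟩
  count Q                           ∎
  where
  open ≤-Reasoning
  P′⇒Q : ∀ i → T (addPoint P x i) → T (Q i)
  P′⇒Q i P′i = [ P⇒Q i , (λ { refl → Qx }) ]′ (addPoint⇒ {P = P} P′i)
  fresh : ∀ {i} → x ≢ i × (¬ T (P i) × T (Q i)) → ¬ T (addPoint P x i) × T (Q i)
  fresh (x≢i , ¬Pi , Qi) = [ ¬Pi , x≢i ∘ sym ]′ ∘ addPoint⇒ {P = P} , Qi

count-≥-length : ∀ {n} {Q : Fin n → Bool} {xs} → Unique xs → All (T ∘ Q) xs → length xs ≤ count Q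
count-≥-length {n} {Q} {xs} unique Qs =
  subst (λ c → c + length xs ≤ count Q) (count-none {n} {λ _ → false} (λ _ ()))
  (count-extend {P = λ _ → false} (λ _ ()) unique (All.map (λ Qi → (λ ()) , Qi) Qs))

witness-or-count-zero : ∀ {n} (P : Fin n → Bool) → (∃ λ i → T (P i)) ⊎ count P ≡ 0
witness-or-count-zero P with Fin.any? (T? ∘ P)
... | yes witness = inj₁ witness
... | no  none    = inj₂ (count-none (λ i Pi → none (i , Pi)))

product-tabulate-2^ : ∀ {n} (e : Fin n → ℕ) → product (tabulate (λ i → 2 ^ e i)) ≡ 2 ^ sum e
product-tabulate-2^ {zero}  e = refl
product-tabulate-2^ {suc n} e = begin
  2 ^ e zero * product (tabulate (λ i → 2 ^ e (suc i)))  ≡⟨ cong (2 ^ e zero *_) (product-tabulate-2^ (e ∘ suc)) ⟩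
  2 ^ e zero * 2 ^ sum (e ∘ suc)                        ≡⟨ ^-distribˡ-+-* 2 (e zero) _ ⟨
  2 ^ (e zero + sum (e ∘ suc))                          ∎
  where open ≡-Reasoning

length-filter-tabulate : ∀ {A : Set} {n} (P : A → Bool) (g : Fin n → A) →
  length (filter (λ a → P a Bool.≟ true) (tabulate g)) ≡ count (P ∘ g)
length-filter-tabulate {n = zero}  P g = refl
length-filter-tabulate {n = suc n} P g with P (g zero)
... | true  = cong suc (length-filter-tabulate P (g ∘ suc))
... | false = length-filter-tabulate P (g ∘ suc)

module _ {A : Set} {R : A → A → Set} where

  linked-successor : ∀ {z} ys {y} → Linked R (z ∷ ys ++ [ y ]) → ∃ λ r → r ∈ ys ++ [ y ] × R z r
  linked-successor []      (zy ∷ _) = _ , here refl , zy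
  linked-successor (w ∷ _) (zw ∷ _) = w , here refl , zw

  linked-predecessor : ∀ z zs {y} → Linked R (z ∷ zs ++ [ y ]) → ∃ λ p → p ∈ z ∷ zs × R p y
  linked-predecessor z []       (zy ∷ _)    = z , here refl , zy
  linked-predecessor z (w ∷ ws) (_ ∷ links) with linked-predecessor w ws links
  ... | p , p∈ , py = p , there p∈ , py

exchange-< : ∀ {p′ p x y} → p′ + x ≡ p + y → y < x → p′ < p
exchange-< {p′} {p} {x} {y} eq y<x = +-cancelʳ-< x p′ p (begin-strict
  p′ + x  ≡⟨ eq ⟩
  p + y   <⟨ +-monoʳ-< p y<x ⟩
  p + x   ∎)
  where open ≤-Reasoning

shift-≡⇔ : ∀ {m′ m n′ n p q} → m′ + p ≡ m + q → n′ + p ≡ n + q → (m′ ≡ n′) ⇔ (m ≡ n)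
shift-≡⇔ {m′} {m} {n′} {n} {p} {q} em en = mk⇔
  (λ { refl → +-cancelʳ-≡ q m n (trans (sym em) en) })
  (λ { refl → +-cancelʳ-≡ p m′ n′ (trans em (sym en)) })

≤-from-sum≤2 : ∀ {c′ c} → c′ + c ≤ 2 → 1 ≤ c → c′ ≤ c
≤-from-sum≤2 {c′} {c} c′+c≤2 1≤c with c′ ≤? c
... | yes c′≤c = c′≤c
... | no  c′≰c = contradiction (≤-trans (+-mono-≤ (≤-trans (s≤s 1≤c) (≰⇒> c′≰c)) 1≤c) c′+c≤2) λ { (s≤s (s≤s ())) }

two-or-three : ∀ {k} → 2 ≤ k → k ≤ 3 → k ≡ 2 ⊎ k ≡ 3
two-or-three {0} () _
two-or-three {1} (s≤s ()) _
two-or-three {2} _ _ = inj₁ refl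
two-or-three {3} _ _ = inj₂ refl
two-or-three {suc (suc (suc (suc _)))} _ (s≤s (s≤s (s≤s ())))

walk-cost-< : ∀ {c₁ c₂ c₁′ c₂′ g g′} → 1 ≤ c₁ → 1 ≤ c₂ → c₁′ + c₁ ≤ 2 → c₂′ + c₂ ≤ 2 → g′ ≤ 3 →
  c₁′ ≡ 0 ⊎ g′ < g → 8 * (c₁′ + c₂′) + (g′ + g′) < 8 * (c₁ + c₂) + (g + g)
walk-cost-< {c₁} {c₂} {c₁′} {c₂′} {g} {g′} 1≤c₁ 1≤c₂ _ sum₂ g′≤3 (inj₁ refl) = begin-strict
  8 * c₂′ + (g′ + g′)      ≤⟨ +-mono-≤ (*-monoʳ-≤ 8 (≤-from-sum≤2 sum₂ 1≤c₂)) (+-mono-≤ g′≤3 g′≤3) ⟩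
  8 * c₂ + 6               <⟨ +-monoʳ-< (8 * c₂) (n≤1+n 7) ⟩
  8 * c₂ + 8 * 1           ≤⟨ +-monoʳ-≤ (8 * c₂) (*-monoʳ-≤ 8 1≤c₁) ⟩
  8 * c₂ + 8 * c₁          ≡⟨ +-comm (8 * c₂) _ ⟩
  8 * c₁ + 8 * c₂          ≡⟨ *-distribˡ-+ 8 c₁ c₂ ⟨
  8 * (c₁ + c₂)            ≤⟨ m≤m+n _ (g + g) ⟩
  8 * (c₁ + c₂) + (g + g)  ∎
  where open ≤-Reasoning
walk-cost-< 1≤c₁ 1≤c₂ sum₁ sum₂ _ (inj₂ g′<g) =
  +-mono-≤-< (*-monoʳ-≤ 8 (+-mono-≤ (≤-from-sum≤2 sum₁ 1≤c₁) (≤-from-sum≤2 sum₂ 1≤c₂))) (+-mono-< g′<g g′<g)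

spare-cost-< : ∀ {c₁ c₂ c₁′ c₂′} → 2 ≤ c₁ → c₁′ + c₁ ≤ 2 → c₂′ ≤ 2 →
  8 * (c₁′ + c₂′) + (1 + 0) < 8 * (c₁ + c₂) + (0 + 2)
spare-cost-< {c₁} {c₂} {c₁′} {c₂′} 2≤c₁ sum₁ c₂′≤2 = begin-strict
  8 * (c₁′ + c₂′) + 1  ≡⟨ cong (λ c → 8 * (c + c₂′) + 1) c₁′≡0 ⟩
  8 * c₂′ + 1          ≤⟨ +-monoˡ-≤ 1 (*-monoʳ-≤ 8 c₂′≤2) ⟩
  17                   <⟨ n<1+n 17 ⟩
  8 * 2 + 2            ≤⟨ +-monoˡ-≤ 2 (*-monoʳ-≤ 8 (≤-trans 2≤c₁ (m≤m+n c₁ c₂))) ⟩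
  8 * (c₁ + c₂) + 2    ∎
  where
  open ≤-Reasoning
  c₁′≡0 : c₁′ ≡ 0
  c₁′≡0 = n≤0⇒n≡0 (+-cancelʳ-≤ c₁ c₁′ 0 (≤-trans sum₁ 2≤c₁))

isTwo : Label → Bool
isTwo one = false
isTwo two = true

toggle : Label → Label
toggle one = two
toggle two = one

bit : Label → ℕ
bit = χ ∘ isTwo

bit-shift-≢ : ∀ {m′ m} l → m′ + bit l ≡ m + bit (toggle l) → m′ ≢ m
bit-shift-≢ one eq refl with +-cancelˡ-≡ _ 0 1 eq
... | ()
bit-shift-≢ two eq refl with +-cancelˡ-≡ _ 1 0 eq
... | ()

bit-shift-up : ∀ {m′ m l} → l ≡ one → m′ + bit l ≡ m + bit (toggle l) → m′ ≡ suc m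
bit-shift-up {m′} {m} refl eq = trans (sym (+-identityʳ m′)) (trans eq (+-comm m 1))

bit-shift-down : ∀ {m′ m l} → l ≡ two → m′ + bit l ≡ m + bit (toggle l) → suc m′ ≡ m
bit-shift-down {m′} {m} refl eq = trans (+-comm 1 m′) (trans eq (+-identityʳ m))

module LevelSets {n : ℕ} (G : Graph n) where

  Labelling : Set
  Labelling = TwoLabelling G

  allOnes : Labelling
  allOnes = record { lab = λ _ _ → one ; lab-sym = λ _ _ → refl }

  twoEdge : Labelling → Fin n → Fin n → Bool
  twoEdge ℓ u v = adj G u v ∧ isTwo (lab ℓ u v)

  twos : Labelling → Fin n → ℕ
  twos ℓ u = count (twoEdge ℓ u)

  ρ≡2^twos : ∀ ℓ v → ρ ℓ v ≡ 2 ^ twos ℓ v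
  ρ≡2^twos ℓ v = begin
    product (map factor (tabulate id))                ≡⟨ cong product (map-tabulate id factor) ⟩
    product (tabulate factor)                         ≡⟨ cong product (tabulate-cong factor≡) ⟩
    product (tabulate (λ u → 2 ^ χ (twoEdge ℓ v u)))  ≡⟨ product-tabulate-2^ (χ ∘ twoEdge ℓ v) ⟩
    2 ^ twos ℓ v                                      ∎
    where
    open ≡-Reasoning
    factor : Fin n → ℕ
    factor u = if adj G v u then val (lab ℓ v u) else 1
    factor≡ : ∀ u → factor u ≡ 2 ^ χ (twoEdge ℓ v u)
    factor≡ u with adj G v u | lab ℓ v u
    ... | false | _   = refl
    ... | true  | one = refl
    ... | true  | two = refl

  ρ-level : ∀ ℓ {v x} → ρ ℓ v ≡ x → twos ℓ v ≡ ⌊log₂ x ⌋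
  ρ-level ℓ {v} refl = trans (sym (⌊log₂[2^n]⌋≡n (twos ℓ v))) (cong ⌊log₂_⌋ (sym (ρ≡2^twos ℓ v)))

  Adj⇒≢ : ∀ {u v} → Adj G u v → u ≢ v
  Adj⇒≢ {u} uv refl = subst T (irrefl G u) uv

  Adj-sym : ∀ {u v} → Adj G u v → Adj G v u
  Adj-sym {u} {v} = subst T (Graph.sym G u v)

  _==_ : Fin n → Fin n → Bool
  a == b = does (a Fin.≟ b)

  ==-refl : ∀ a → a == a ≡ true
  ==-refl a = dec-true (a Fin.≟ a) refl

  ==-≢ : ∀ {a b} → a ≢ b → a == b ≡ false
  ==-≢ {a} {b} = dec-false (a Fin.≟ b)

  sameEdge : Fin n → Fin n → Fin n → Fin n → Bool
  sameEdge x y a b = (a == x ∧ b == y) ∨ (a == y ∧ b == x)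

  sameEdge-sym : ∀ x y a b → sameEdge x y a b ≡ sameEdge x y b a
  sameEdge-sym x y a b = begin
    (a == x ∧ b == y) ∨ (a == y ∧ b == x)  ≡⟨ cong₂ _∨_ (∧-comm (a == x) _) (∧-comm (a == y) _) ⟩
    (b == y ∧ a == x) ∨ (b == x ∧ a == y)  ≡⟨ ∨-comm (b == y ∧ a == x) _ ⟩
    (b == x ∧ a == y) ∨ (b == y ∧ a == x)  ∎
    where open ≡-Reasoning

  sameEdge-source : ∀ {x y} → x ≢ y → ∀ b → sameEdge x y x b ≡ b == y
  sameEdge-source {x} {y} x≢y b rewrite ==-refl x | ==-≢ x≢y = ∨-identityʳ (b == y)

  sameEdge-target : ∀ {x y} → x ≢ y → ∀ b → sameEdge x y y b ≡ b == x
  sameEdge-target {x} {y} x≢y b rewrite ==-refl y | ==-≢ (x≢y ∘ sym) = refl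

  flip : Labelling → Fin n → Fin n → Labelling
  flip ℓ x y = record
    { lab     = λ a b → if sameEdge x y a b then toggle (lab ℓ a b) else lab ℓ a b
    ; lab-sym = λ a b → cong₂ (λ e l → if e then toggle l else l) (sameEdge-sym x y a b) (lab-sym ℓ a b)
    }

  twos-flip-away : ∀ ℓ {x y a} → a ≢ x → a ≢ y → twos (flip ℓ x y) a ≡ twos ℓ a
  twos-flip-away ℓ {x} {y} {a} a≢x a≢y = sum-cong-≗ unchanged
    where
    unchanged : ∀ b → χ (twoEdge (flip ℓ x y) a b) ≡ χ (twoEdge ℓ a b)
    unchanged b rewrite ==-≢ a≢x | ==-≢ a≢y = refl

  twos-flip-end : ∀ ℓ {x y a c} → (∀ b → sameEdge x y a b ≡ b == c) → Adj G a c →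
    twos (flip ℓ x y) a + bit (lab ℓ a c) ≡ twos ℓ a + bit (toggle (lab ℓ a c))
  twos-flip-end ℓ {x} {y} {a} {c} edge ac = begin
    twos (flip ℓ x y) a + bit (lab ℓ a c)    ≡⟨ cong (twos (flip ℓ x y) a +_) old ⟨
    twos (flip ℓ x y) a + χ (twoEdge ℓ a c)  ≡⟨ sum-exchange c unchanged ⟩
    twos ℓ a + χ (twoEdge (flip ℓ x y) a c)  ≡⟨ cong (twos ℓ a +_) new ⟩
    twos ℓ a + bit (toggle (lab ℓ a c))      ∎
    where
    open ≡-Reasoning
    unchanged : ∀ b → b ≢ c → χ (twoEdge (flip ℓ x y) a b) ≡ χ (twoEdge ℓ a b)
    unchanged b b≢c rewrite edge b | ==-≢ b≢c = refl
    old : χ (twoEdge ℓ a c) ≡ bit (lab ℓ a c)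
    old rewrite T-≡ .to ac = refl
    new : χ (twoEdge (flip ℓ x y) a c) ≡ bit (toggle (lab ℓ a c))
    new rewrite T-≡ .to ac | edge c | ==-refl c = refl

  onLevel : Labelling → ℕ → Fin n → Bool
  onLevel ℓ k b = twos ℓ b ≡ᵇ k

  mono : Labelling → Fin n → Fin n → ℕ
  mono ℓ a b = χ (adj G a b ∧ onLevel ℓ (twos ℓ a) b)

  mono-sym : ∀ ℓ a b → mono ℓ a b ≡ mono ℓ b a
  mono-sym ℓ a b = cong χ (cong₂ _∧_ (Graph.sym G a b)
    (does-⇔ (mk⇔ sym sym) (twos ℓ b ≟ twos ℓ a) (twos ℓ a ≟ twos ℓ b)))

  mono-diag : ∀ ℓ a → mono ℓ a a ≡ 0
  mono-diag ℓ a rewrite irrefl G a = refl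

  otherNeighbour : Fin n → Fin n → Fin n → Bool
  otherNeighbour x y b = adj G x b ∧ not (b == y)

  otherNeighbour⇒ : ∀ {x y b} → T (otherNeighbour x y b) → Adj G x b × b ≢ y
  otherNeighbour⇒ {x} {y} {b} _ with adj G x b | b Fin.≟ y
  ... | true | no b≢y = _ , b≢y

  otherNeighbourOnLevel : Labelling → Fin n → Fin n → ℕ → Fin n → Bool
  otherNeighbourOnLevel ℓ x y k b = otherNeighbour x y b ∧ onLevel ℓ k b

  neighboursOnLevel : Labelling → Fin n → Fin n → ℕ → ℕ
  neighboursOnLevel ℓ x y k = count (otherNeighbourOnLevel ℓ x y k)

  mono-row : ∀ ℓ x y → sum (mono ℓ x) ≡ mono ℓ x y + neighboursOnLevel ℓ x y (twos ℓ x)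
  mono-row ℓ x y = begin
    sum (mono ℓ x)                                        ≡⟨ +-identityʳ _ ⟨
    sum (mono ℓ x) + 0                                    ≡⟨ cong (sum (mono ℓ x) +_) excluded ⟨
    sum (mono ℓ x) + χ (otherNeighbourOnLevel ℓ x y k y)  ≡⟨ sum-exchange y agree ⟩
    neighboursOnLevel ℓ x y k + mono ℓ x y                ≡⟨ +-comm _ (mono ℓ x y) ⟩
    mono ℓ x y + neighboursOnLevel ℓ x y k                ∎
    where
    open ≡-Reasoning
    k : ℕ
    k = twos ℓ x
    excluded : χ (otherNeighbourOnLevel ℓ x y k y) ≡ 0
    excluded rewrite ==-refl y | ∧-zeroʳ (adj G x y) = refl
    agree : ∀ b → b ≢ y → mono ℓ x b ≡ χ (otherNeighbourOnLevel ℓ x y k b)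
    agree b b≢y rewrite ==-≢ b≢y | ∧-identityʳ (adj G x b) = refl

  neighboursOnLevel-cong : ∀ {ℓ ℓ′ x y} k → (∀ b → b ≢ x → b ≢ y → twos ℓ′ b ≡ twos ℓ b) →
    neighboursOnLevel ℓ′ x y k ≡ neighboursOnLevel ℓ x y k
  neighboursOnLevel-cong {ℓ} {ℓ′} {x} {y} k same = sum-cong-≗ pointwise
    where
    pointwise : ∀ b → χ (otherNeighbourOnLevel ℓ′ x y k b) ≡ χ (otherNeighbourOnLevel ℓ x y k b)
    pointwise b = cong χ (∧-congˡ λ other →
      let xb , b≢y = otherNeighbour⇒ other in cong (_≡ᵇ k) (same b (Adj⇒≢ xb ∘ sym) b≢y))

  -- The values are tuned to the moves made below: raising a vertex from level 0 or 1, lowering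
  -- one from level 3 to 2, and raising the ends of an edge from levels (2, 1) to (3, 2).
  penalty : ℕ → ℕ
  penalty 0 = 3
  penalty 1 = 2
  penalty 2 = 0
  penalty 3 = 1
  penalty (suc (suc (suc (suc _)))) = 0

  penalty≤3 : ∀ k → penalty k ≤ 3
  penalty≤3 0                         = ≤-refl
  penalty≤3 1                         = n≤1+n 2
  penalty≤3 2                         = z≤n
  penalty≤3 3                         = s≤s z≤n
  penalty≤3 (suc (suc (suc (suc _)))) = z≤n

  penalty-suc-< : ∀ {k} → k ≤ 1 → penalty (suc k) < penalty k
  penalty-suc-< z≤n       = s≤s (s≤s (s≤s z≤n))
  penalty-suc-< (s≤s z≤n) = s≤s z≤n

  potential : Labelling → ℕ
  potential ℓ = 4 * total (mono ℓ) + sum (penalty ∘ twos ℓ)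

  Improvement : Labelling → Set
  Improvement ℓ = ∃ λ ℓ′ → potential ℓ′ < potential ℓ

  endpointCost : Labelling → Fin n → Fin n → ℕ → ℕ → ℕ
  endpointCost ℓ x y kx ky =
    8 * (neighboursOnLevel ℓ x y kx + neighboursOnLevel ℓ y x ky) + (penalty kx + penalty ky)

  module _ (ℓ : Labelling) {x y : Fin n} (xy : Adj G x y) where

    private
      ℓ′ : Labelling
      ℓ′ = flip ℓ x y
      x≢y : x ≢ y
      x≢y = Adj⇒≢ xy
      away : ∀ {a} → a ≢ x → a ≢ y → twos ℓ′ a ≡ twos ℓ a
      away = twos-flip-away ℓ

    twos-flip-source : twos ℓ′ x + bit (lab ℓ x y) ≡ twos ℓ x + bit (toggle (lab ℓ x y))
    twos-flip-source = twos-flip-end ℓ (sameEdge-source x≢y) xy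

    twos-flip-target : twos ℓ′ y + bit (lab ℓ x y) ≡ twos ℓ y + bit (toggle (lab ℓ x y))
    twos-flip-target = subst (λ l → twos ℓ′ y + bit l ≡ twos ℓ y + bit (toggle l)) (lab-sym ℓ y x)
      (twos-flip-end ℓ (sameEdge-target x≢y) (Adj-sym xy))

    flip-moves-source : twos ℓ′ x ≢ twos ℓ x
    flip-moves-source = bit-shift-≢ (lab ℓ x y) twos-flip-source

    flip-preserves-level-agreement : (twos ℓ′ y ≡ twos ℓ′ x) ⇔ (twos ℓ y ≡ twos ℓ x)
    flip-preserves-level-agreement = shift-≡⇔ twos-flip-target twos-flip-source

    flip-up : lab ℓ x y ≡ one → twos ℓ′ x ≡ suc (twos ℓ x) × twos ℓ′ y ≡ suc (twos ℓ y)
    flip-up l≡one = bit-shift-up l≡one twos-flip-source , bit-shift-up l≡one twos-flip-target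

    flip-down : lab ℓ x y ≡ two → suc (twos ℓ′ x) ≡ twos ℓ x × suc (twos ℓ′ y) ≡ twos ℓ y
    flip-down l≡two = bit-shift-down l≡two twos-flip-source , bit-shift-down l≡two twos-flip-target

    mono-flip-away : ∀ a b → a ≢ x → a ≢ y → b ≢ x → b ≢ y → mono ℓ′ a b ≡ mono ℓ a b
    mono-flip-away a b a≢x a≢y b≢x b≢y =
      cong₂ (λ ka kb → χ (adj G a b ∧ (kb ≡ᵇ ka))) (away a≢x a≢y) (away b≢x b≢y)

    mono-flip-edge : mono ℓ′ x y ≡ mono ℓ x y
    mono-flip-edge = cong (λ e → χ (adj G x y ∧ e))
      (does-⇔ flip-preserves-level-agreement (twos ℓ′ y ≟ twos ℓ′ x) (twos ℓ y ≟ twos ℓ x))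

    mono-row-flip : ∀ {a c} → mono ℓ′ a c ≡ mono ℓ a c → (∀ b → b ≢ a → b ≢ c → twos ℓ′ b ≡ twos ℓ b) →
      sum (mono ℓ′ a) ≡ mono ℓ a c + neighboursOnLevel ℓ a c (twos ℓ′ a)
    mono-row-flip {a} {c} same-ac same-levels =
      trans (mono-row ℓ′ a c) (cong₂ _+_ same-ac (neighboursOnLevel-cong {ℓ} {ℓ′} (twos ℓ′ a) same-levels))

    total-mono-flip : total (mono ℓ′) + 2 * (neighboursOnLevel ℓ x y (twos ℓ x) + neighboursOnLevel ℓ y x (twos ℓ y))
                    ≡ total (mono ℓ) + 2 * (neighboursOnLevel ℓ x y (twos ℓ′ x) + neighboursOnLevel ℓ y x (twos ℓ′ y))
    total-mono-flip = +-cancelʳ-≡ (2 * (mxy + myx)) _ _ (begin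
      total (mono ℓ′) + 2 * (Nx + Ny) + 2 * (mxy + myx)         ≡⟨ regroup (total (mono ℓ′)) Nx Ny mxy myx ⟩
      total (mono ℓ′) + 2 * ((mxy + Nx) + (myx + Ny))           ≡⟨ cong (λ r → total (mono ℓ′) + 2 * r) rows ⟨
      total (mono ℓ′) + 2 * (sum (mono ℓ x) + sum (mono ℓ y))
        ≡⟨ total-exchange x≢y (mono-sym ℓ) (mono-sym ℓ′) (mono-diag ℓ) (mono-diag ℓ′) mono-flip-away mono-flip-edge ⟩
      total (mono ℓ) + 2 * (sum (mono ℓ′ x) + sum (mono ℓ′ y))  ≡⟨ cong (λ r → total (mono ℓ) + 2 * r) rows′ ⟩
      total (mono ℓ) + 2 * ((mxy + N′x) + (myx + N′y))          ≡⟨ regroup (total (mono ℓ)) N′x N′y mxy myx ⟨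
      total (mono ℓ) + 2 * (N′x + N′y) + 2 * (mxy + myx)        ∎)
      where
      open ≡-Reasoning
      mxy myx Nx Ny N′x N′y : ℕ
      mxy = mono ℓ x y
      myx = mono ℓ y x
      Nx = neighboursOnLevel ℓ x y (twos ℓ x)
      Ny = neighboursOnLevel ℓ y x (twos ℓ y)
      N′x = neighboursOnLevel ℓ x y (twos ℓ′ x)
      N′y = neighboursOnLevel ℓ y x (twos ℓ′ y)
      regroup : ∀ m a b p q → m + 2 * (a + b) + 2 * (p + q) ≡ m + 2 * ((p + a) + (q + b))
      regroup = solve-∀
      rows : sum (mono ℓ x) + sum (mono ℓ y) ≡ (mxy + Nx) + (myx + Ny)
      rows = cong₂ _+_ (mono-row ℓ x y) (mono-row ℓ y x)
      rows′ : sum (mono ℓ′ x) + sum (mono ℓ′ y) ≡ (mxy + N′x) + (myx + N′y)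
      rows′ = cong₂ _+_
        (mono-row-flip mono-flip-edge λ b b≢x b≢y → away b≢x b≢y)
        (mono-row-flip (trans (mono-sym ℓ′ y x) (trans mono-flip-edge (mono-sym ℓ x y))) λ b b≢y b≢x → away b≢x b≢y)

    -- potential ℓ − endpointCost ℓ x y (twos ℓ x) (twos ℓ y) is invariant under the flip, since
    -- the edge xy keeps its colour; 8 = 4 · 2 because total counts each edge in both directions.
    potential-flip : potential ℓ′ + endpointCost ℓ x y (twos ℓ x) (twos ℓ y)
                   ≡ potential ℓ + endpointCost ℓ x y (twos ℓ′ x) (twos ℓ′ y)
    potential-flip = begin
      4 * M′ + P′ + (8 * (Nx + Ny) + (gx + gy))      ≡⟨ regroup M′ P′ Nx Ny gx gy ⟩
      4 * (M′ + 2 * (Nx + Ny)) + (P′ + (gx + gy))    ≡⟨ cong₂ (λ m p → 4 * m + p) total-mono-flip penalties ⟩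
      4 * (M + 2 * (N′x + N′y)) + (P + (g′x + g′y))  ≡⟨ regroup M P N′x N′y g′x g′y ⟨
      4 * M + P + (8 * (N′x + N′y) + (g′x + g′y))    ∎
      where
      open ≡-Reasoning
      M′ M P′ P Nx Ny N′x N′y gx gy g′x g′y : ℕ
      M′ = total (mono ℓ′)
      M = total (mono ℓ)
      P′ = sum (penalty ∘ twos ℓ′)
      P = sum (penalty ∘ twos ℓ)
      Nx = neighboursOnLevel ℓ x y (twos ℓ x)
      Ny = neighboursOnLevel ℓ y x (twos ℓ y)
      N′x = neighboursOnLevel ℓ x y (twos ℓ′ x)
      N′y = neighboursOnLevel ℓ y x (twos ℓ′ y)
      gx = penalty (twos ℓ x)
      gy = penalty (twos ℓ y)
      g′x = penalty (twos ℓ′ x)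
      g′y = penalty (twos ℓ′ y)
      penalties : P′ + (gx + gy) ≡ P + (g′x + g′y)
      penalties = sum-exchange₂ x≢y (λ a a≢x a≢y → cong penalty (away a≢x a≢y))
      regroup : ∀ m p a b c d → 4 * m + p + (8 * (a + b) + (c + d)) ≡ 4 * (m + 2 * (a + b)) + (p + (c + d))
      regroup = solve-∀

    potential-flip-< : endpointCost ℓ x y (twos ℓ′ x) (twos ℓ′ y) < endpointCost ℓ x y (twos ℓ x) (twos ℓ y) →
      potential ℓ′ < potential ℓ
    potential-flip-< = exchange-< potential-flip

  record MonoWalk (ℓ : Labelling) (u a b p r : Fin n) : Set where
    constructor monoWalk
    field
      ua  : Adj G u a
      ub  : Adj G u b
      a≢b : a ≢ b
      ap  : Adj G a p
      p≢u : p ≢ u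
      br  : Adj G b r
      r≢u : r ≢ u
      a∼u : twos ℓ a ≡ twos ℓ u
      b∼u : twos ℓ b ≡ twos ℓ u
      p∼u : twos ℓ p ≡ twos ℓ u
      r∼u : twos ℓ r ≡ twos ℓ u

  reverseWalk : ∀ {ℓ u a b p r} → MonoWalk ℓ u a b p r → MonoWalk ℓ u b a r p
  reverseWalk (monoWalk ua ub a≢b ap p≢u br r≢u a∼u b∼u p∼u r∼u) =
    monoWalk ub ua (a≢b ∘ sym) br r≢u ap p≢u b∼u a∼u r∼u p∼u

  HasMonoWalk : Labelling → Set
  HasMonoWalk ℓ = ∃ λ u → ∃ λ a → ∃ λ b → ∃ λ p → ∃ λ r → MonoWalk ℓ u a b p r

  monoWalk? : ∀ ℓ u a b p r → Dec (MonoWalk ℓ u a b p r)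
  monoWalk? ℓ u a b p r = map′
    (λ (ua , ub , a≢b , ap , p≢u , br , r≢u , a∼u , b∼u , p∼u , r∼u) →
      monoWalk ua ub a≢b ap p≢u br r≢u a∼u b∼u p∼u r∼u)
    (λ (monoWalk ua ub a≢b ap p≢u br r≢u a∼u b∼u p∼u r∼u) →
      ua , ub , a≢b , ap , p≢u , br , r≢u , a∼u , b∼u , p∼u , r∼u)
    (T? (adj G u a) ×-dec T? (adj G u b) ×-dec ¬? (a Fin.≟ b) ×-dec T? (adj G a p) ×-dec ¬? (p Fin.≟ u) ×-dec
     T? (adj G b r) ×-dec ¬? (r Fin.≟ u) ×-dec (twos ℓ a ≟ twos ℓ u) ×-dec (twos ℓ b ≟ twos ℓ u) ×-dec
     (twos ℓ p ≟ twos ℓ u) ×-dec (twos ℓ r ≟ twos ℓ u))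

  hasMonoWalk? : ∀ ℓ → Dec (HasMonoWalk ℓ)
  hasMonoWalk? ℓ = Fin.any? λ u → Fin.any? λ a → Fin.any? λ b → Fin.any? λ p → Fin.any? λ r → monoWalk? ℓ u a b p r

  -- Centre the walk at x₁; p precedes x₀ and r follows x₂ on the cycle.
  cycle⇒monoWalk : ∀ ℓ {c k} → IsCycle G c → All (λ v → twos ℓ v ≡ k) c → HasMonoWalk ℓ
  cycle⇒monoWalk ℓ {_ ∷ []}     (_ , s≤s () , _)       _
  cycle⇒monoWalk ℓ {_ ∷ _ ∷ []} (_ , s≤s (s≤s ()) , _) _
  cycle⇒monoWalk ℓ {x₀ ∷ x₁ ∷ x₂ ∷ rest} {k} ((x₀≢x₁ ∷ x₀≢x₂ ∷ _) ∷ x₁∉ ∷ _ , _ , x₀x₁ ∷ x₁x₂ ∷ links) levels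
    with linked-predecessor x₂ rest links | linked-successor rest links
  ... | p , p∈ , px₀ | r , r∈ , x₂r =
    x₁ , x₀ , x₂ , p , r ,
    monoWalk (Adj-sym x₀x₁) x₁x₂ x₀≢x₂ (Adj-sym px₀) (All.lookup x₁∉ p∈ ∘ sym) x₂r
             (All.lookup (++⁺ (All.tail x₁∉) ((x₀≢x₁ ∘ sym) ∷ [])) r∈ ∘ sym)
             (same (All.head levels)) (same (All.lookup levels (there (there (here refl)))))
             (same (All.lookup levels (there (there p∈))))
             (same (All.lookup (++⁺ (All.tail (All.tail (All.tail levels))) (All.head levels ∷ [])) r∈))
    where
    same : ∀ {v} → twos ℓ v ≡ k → twos ℓ v ≡ twos ℓ x₁
    same v∼k = trans v∼k (sym (All.lookup levels (there (here refl))))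

module MaxDegreeThree {n : ℕ} (G : Graph n) (Δ≤3 : MaxDegreeAtMost G 3) where

  open LevelSets G

  count-neighbours≤3 : ∀ v → count (adj G v) ≤ 3
  count-neighbours≤3 v = subst (_≤ 3) (length-filter-tabulate (adj G v) id) (Δ≤3 v)

  neighbours-extend : ∀ {v} {P : Fin n → Bool} {xs} → (∀ i → T (P i) → Adj G v i) → Unique xs →
    All (λ i → ¬ T (P i) × Adj G v i) xs → count P + length xs ≤ 3
  neighbours-extend {v} P⇒adj unique new = ≤-trans (count-extend P⇒adj unique new) (count-neighbours≤3 v)

  neighbours-distinct : ∀ {v xs} → Unique xs → All (Adj G v) xs → length xs ≤ 3
  neighbours-distinct {v} unique adjs = ≤-trans (count-≥-length unique adjs) (count-neighbours≤3 v)

  otherNeighbours≤2 : ∀ {x y} → Adj G x y → count (otherNeighbour x y) ≤ 2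
  otherNeighbours≤2 {x} {y} xy = +-cancelʳ-≤ 1 _ 2 (neighbours-extend (λ b → proj₁ ∘ otherNeighbour⇒) ([] ∷ [])
    (((λ other → proj₂ (otherNeighbour⇒ other) refl) , xy) ∷ []))

  module _ (ℓ : Labelling) where

    twos≤3 : ∀ u → twos ℓ u ≤ 3
    twos≤3 u = ≤-trans (count-mono {P = twoEdge ℓ u} (λ b → proj₁ ∘ T-∧ .to)) (count-neighbours≤3 u)

    twos-≥ : ∀ {u xs} → Unique xs → All (λ b → Adj G u b × lab ℓ u b ≡ two) xs → length xs ≤ twos ℓ u
    twos-≥ {u} unique twoEdges = count-≥-length unique (All.map toTwoEdge twoEdges)
      where
      toTwoEdge : ∀ {b} → Adj G u b × lab ℓ u b ≡ two → T (twoEdge ℓ u b)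
      toTwoEdge (ub , l≡two) = T-∧ .from (ub , subst (T ∘ isTwo) (sym l≡two) _)

    twos-≤ : ∀ {u xs} → Unique xs → All (λ b → Adj G u b × lab ℓ u b ≡ one) xs → twos ℓ u + length xs ≤ 3
    twos-≤ {u} unique oneEdges = neighbours-extend (λ b → proj₁ ∘ T-∧ .to) unique (All.map notTwoEdge oneEdges)
      where
      notTwoEdge : ∀ {b} → Adj G u b × lab ℓ u b ≡ one → ¬ T (twoEdge ℓ u b) × Adj G u b
      notTwoEdge (ub , l≡one) = (λ e → subst (T ∘ isTwo) l≡one (proj₂ (T-∧ .to e))) , ub

  module _ (ℓ : Labelling) {x y : Fin n} where

    onLevel⇔ : ∀ {k b} → T (otherNeighbourOnLevel ℓ x y k b) ⇔ (Adj G x b × b ≢ y × twos ℓ b ≡ k)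
    onLevel⇔ {k} {b} = mk⇔ forward backward
      where
      forward : T (otherNeighbourOnLevel ℓ x y k b) → Adj G x b × b ≢ y × twos ℓ b ≡ k
      forward on = let other , level = T-∧ .to on ; xb , b≢y = otherNeighbour⇒ other
                   in xb , b≢y , ≡ᵇ⇒≡ _ _ level
      backward : Adj G x b × b ≢ y × twos ℓ b ≡ k → T (otherNeighbourOnLevel ℓ x y k b)
      backward (xb , b≢y , level) = T-∧ .from (T-∧ .from (xb , T-not-≡ .from (==-≢ b≢y)) , ≡⇒≡ᵇ _ _ level)

    neighboursOnLevel-≥ : ∀ {k xs} → Unique xs → All (λ b → Adj G x b × b ≢ y × twos ℓ b ≡ k) xs →
      length xs ≤ neighboursOnLevel ℓ x y k
    neighboursOnLevel-≥ unique onLevel = count-≥-length unique (All.map (onLevel⇔ .from) onLevel)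

    neighboursOnLevel-none : ∀ {k} → (∀ b → Adj G x b → b ≢ y → twos ℓ b ≢ k) → neighboursOnLevel ℓ x y k ≡ 0
    neighboursOnLevel-none none = count-none λ b on → let xb , b≢y , level = onLevel⇔ .to on in none b xb b≢y level

    neighboursOnLevel-≤2 : ∀ {k} → Adj G x y → neighboursOnLevel ℓ x y k ≤ 2
    neighboursOnLevel-≤2 {k} xy =
      ≤-trans (count-mono {P = otherNeighbourOnLevel ℓ x y k} (λ b → proj₁ ∘ T-∧ .to)) (otherNeighbours≤2 xy)

    neighboursOnLevel-pair : ∀ {k k′} → Adj G x y → k ≢ k′ →
      neighboursOnLevel ℓ x y k + neighboursOnLevel ℓ x y k′ ≤ 2
    neighboursOnLevel-pair {k} {k′} xy k≢k′ = ≤-trans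
      (count-disjoint {P = otherNeighbourOnLevel ℓ x y k} {otherNeighbourOnLevel ℓ x y k′}
        (λ b on on′ → k≢k′ (trans (sym (level on)) (level on′))) (λ b → proj₁ ∘ T-∧ .to) (λ b → proj₁ ∘ T-∧ .to))
      (otherNeighbours≤2 xy)
      where
      level : ∀ {k b} → T (otherNeighbourOnLevel ℓ x y k b) → twos ℓ b ≡ k
      level = proj₂ ∘ proj₂ ∘ onLevel⇔ .to

  -- Toggling ua carries a along with u, so b and p stop sharing a level with u and a.
  flip-walk-edge : ∀ {ℓ u a b p r} → MonoWalk ℓ u a b p r →
    neighboursOnLevel ℓ u a (twos (flip ℓ u a) u) ≡ 0 ⊎ penalty (twos (flip ℓ u a) u) < penalty (twos ℓ u) →
    potential (flip ℓ u a) < potential ℓ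
  flip-walk-edge {ℓ} {u} {a} (monoWalk ua ub a≢b ap p≢u _ _ a∼u b∼u p∼u _) decrease = potential-flip-< ℓ ua
    (subst₂ (λ ka′ ka → endpointCost ℓ u a (twos ℓ′ u) ka′ < endpointCost ℓ u a (twos ℓ u) ka)
      (sym (flip-preserves-level-agreement ℓ ua .from a∼u)) (sym a∼u)
      (walk-cost-<
        (neighboursOnLevel-≥ ℓ ([] ∷ []) ((ub , a≢b ∘ sym , b∼u) ∷ []))
        (neighboursOnLevel-≥ ℓ ([] ∷ []) ((ap , p≢u , p∼u) ∷ []))
        (neighboursOnLevel-pair ℓ ua (flip-moves-source ℓ ua))
        (neighboursOnLevel-pair ℓ (Adj-sym ua) (flip-moves-source ℓ ua))
        (penalty≤3 (twos ℓ′ u)) decrease))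
    where
    ℓ′ : Labelling
    ℓ′ = flip ℓ u a

  flip-spare-edge : ∀ {ℓ u a b w} → Adj G u a → Adj G u b → Adj G u w → a ≢ b →
    twos ℓ u ≡ 2 → twos ℓ a ≡ 2 → twos ℓ b ≡ 2 → twos ℓ w ≡ 1 → lab ℓ u w ≡ one →
    potential (flip ℓ u w) < potential ℓ
  flip-spare-edge {ℓ} {u} {a} {b} {w} ua ub uw a≢b u∼2 a∼2 b∼2 w∼1 l≡one = potential-flip-< ℓ uw
    (subst₂ (λ ku′ kw′ → endpointCost ℓ u w ku′ kw′ < endpointCost ℓ u w (twos ℓ u) (twos ℓ w))
      (sym (trans (proj₁ (flip-up ℓ uw l≡one)) (cong suc u∼2)))
      (sym (trans (proj₂ (flip-up ℓ uw l≡one)) (cong suc w∼1)))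
      (subst₂ (λ ku kw → endpointCost ℓ u w 3 2 < endpointCost ℓ u w ku kw) (sym u∼2) (sym w∼1)
        (spare-cost-<
          (neighboursOnLevel-≥ ℓ ((a≢b ∷ []) ∷ [] ∷ []) ((ua , ≢w a∼2 , a∼2) ∷ (ub , ≢w b∼2 , b∼2) ∷ []))
          (neighboursOnLevel-pair ℓ uw λ ())
          (neighboursOnLevel-≤2 ℓ (Adj-sym uw)))))
    where
    ≢w : ∀ {v} → twos ℓ v ≡ 2 → v ≢ w
    ≢w v∼2 refl with trans (sym v∼2) w∼1
    ... | ()

  improve-ones : ∀ {ℓ u a b p r} → MonoWalk ℓ u a b p r → lab ℓ u a ≡ one → lab ℓ u b ≡ one → Improvement ℓ
  improve-ones {ℓ} {u} {a} w@(monoWalk ua ub a≢b _ _ _ _ _ _ _ _) la lb = flip ℓ u a , flip-walk-edge w (inj₂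
    (subst (λ k′ → penalty k′ < penalty (twos ℓ u)) (sym (proj₁ (flip-up ℓ ua la))) (penalty-suc-< k≤1)))
    where
    k≤1 : twos ℓ u ≤ 1
    k≤1 = +-cancelʳ-≤ 2 _ 1 (twos-≤ ℓ ((a≢b ∷ []) ∷ [] ∷ []) ((ua , la) ∷ (ub , lb) ∷ []))

  improve-twos : ∀ {ℓ u a b p r} → MonoWalk ℓ u a b p r → lab ℓ u a ≡ two → lab ℓ u b ≡ two → Improvement ℓ
  improve-twos {ℓ} {u} {a} {b} w@(monoWalk ua ub a≢b _ _ _ _ a∼u b∼u _ _) la lb =
    [ level-two , level-three ]′
      (two-or-three (twos-≥ ℓ ((a≢b ∷ []) ∷ [] ∷ []) ((ua , la) ∷ (ub , lb) ∷ [])) (twos≤3 ℓ u))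
    where
    down : suc (twos (flip ℓ u a) u) ≡ twos ℓ u
    down = proj₁ (flip-down ℓ ua la)
    level-three : twos ℓ u ≡ 3 → Improvement ℓ
    level-three k≡3 = flip ℓ u a , flip-walk-edge w (inj₂
      (subst₂ (λ k′ k → penalty k′ < penalty k) (sym (suc-injective (trans down k≡3))) (sym k≡3) (s≤s z≤n)))
    spare-edge : twos ℓ u ≡ 2 → ∀ {c} → Adj G u c × c ≢ a × twos ℓ c ≡ 1 → Improvement ℓ
    spare-edge k≡2 {c} (uc , c≢a , c∼1) = flip ℓ u c , flip-spare-edge {ℓ} ua ub uc a≢b k≡2 a∼2 b∼2 c∼1 lc
      where
      a∼2 : twos ℓ a ≡ 2
      a∼2 = trans a∼u k≡2
      b∼2 : twos ℓ b ≡ 2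
      b∼2 = trans b∼u k≡2
      c≢b : c ≢ b
      c≢b refl with trans (sym b∼2) c∼1
      ... | ()
      lc : lab ℓ u c ≡ one
      lc with lab ℓ u c in l
      ... | one = refl
      ... | two = contradiction
        (subst (3 ≤_) k≡2 (twos-≥ ℓ ((a≢b ∷ c≢a ∘ sym ∷ []) ∷ (c≢b ∘ sym ∷ []) ∷ [] ∷ [])
                                  ((ua , la) ∷ (ub , lb) ∷ (uc , l) ∷ [])))
        λ { (s≤s (s≤s ())) }
    level-two : twos ℓ u ≡ 2 → Improvement ℓ
    level-two k≡2 =
      [ (λ (c , on) → spare-edge k≡2 (onLevel⇔ ℓ .to on))
      , (λ none → flip ℓ u a , flip-walk-edge w (inj₁
          (subst (λ k′ → neighboursOnLevel ℓ u a k′ ≡ 0) (sym (suc-injective (trans down k≡2))) none))) ]′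
      (witness-or-count-zero (otherNeighbourOnLevel ℓ u a 1))

  -- Toggling ua raises u and toggling ub lowers it. If a neighbour c ≠ a already sits on the
  -- higher level, then a, b and c leave no room at u for a neighbour on the lower level.
  improve-mixed : ∀ {ℓ u a b p r} → MonoWalk ℓ u a b p r → lab ℓ u a ≡ one → lab ℓ u b ≡ two → Improvement ℓ
  improve-mixed {ℓ} {u} {a} {b} w@(monoWalk ua ub a≢b _ _ _ _ a∼u b∼u _ _) la lb =
    [ (λ (c , on) → flip ℓ u b , flip-walk-edge (reverseWalk w)
          (inj₁ (neighboursOnLevel-none ℓ (only-a-and-c (onLevel⇔ ℓ .to on)))))
    , (λ none → flip ℓ u a , flip-walk-edge w (inj₁ (subst (λ k → neighboursOnLevel ℓ u a k ≡ 0) (sym up) none))) ]′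
    (witness-or-count-zero (otherNeighbourOnLevel ℓ u a (suc (twos ℓ u))))
    where
    up : twos (flip ℓ u a) u ≡ suc (twos ℓ u)
    up = proj₁ (flip-up ℓ ua la)
    down : suc (twos (flip ℓ u b) u) ≡ twos ℓ u
    down = proj₁ (flip-down ℓ ub lb)
    only-a-and-c : ∀ {c} → Adj G u c × c ≢ a × twos ℓ c ≡ suc (twos ℓ u) →
      ∀ d → Adj G u d → d ≢ b → twos ℓ d ≢ twos (flip ℓ u b) u
    only-a-and-c {c} (uc , c≢a , c∼) d ud d≢b d∼ with d Fin.≟ a | d Fin.≟ c
    ... | yes refl | _        = 1+n≢n (trans (cong suc (trans (sym a∼u) d∼)) down)
    ... | no  _    | yes refl = m≢1+n+m (twos ℓ u) (trans (sym down) (cong suc (trans (sym d∼) c∼)))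
    ... | no  d≢a  | no  d≢c  = contradiction
      (neighbours-distinct
        ((a≢b ∷ c≢a ∘ sym ∷ d≢a ∘ sym ∷ []) ∷ (c≢b ∘ sym ∷ d≢b ∘ sym ∷ []) ∷ (d≢c ∘ sym ∷ []) ∷ [] ∷ [])
        (ua ∷ ub ∷ uc ∷ ud ∷ []))
      λ { (s≤s (s≤s (s≤s ()))) }
      where
      c≢b : c ≢ b
      c≢b refl = 1+n≢n (trans (sym c∼) b∼u)

  improve : ∀ {ℓ u a b p r} → MonoWalk ℓ u a b p r → Improvement ℓ
  improve {ℓ} {u} {a} {b} w with lab ℓ u a in la | lab ℓ u b in lb
  ... | one | one = improve-ones w la lb
  ... | one | two = improve-mixed w la lb
  ... | two | one = improve-mixed (reverseWalk w) lb la
  ... | two | two = improve-twos w la lb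

  search : ∀ ℓ → Acc _<_ (potential ℓ) → ∃ λ ℓ → ¬ HasMonoWalk ℓ
  search ℓ (acc smaller) with hasMonoWalk? ℓ
  ... | no  none                    = ℓ , none
  ... | yes (_ , _ , _ , _ , _ , w) = let ℓ′ , decrease = improve w in search ℓ′ (smaller decrease)

theorem4p4 : ∀ (n : ℕ) (G : Graph n) → MaxDegreeAtMost G 3 →
    Σ (TwoLabelling G) (λ ℓ → ∀ (x : ℕ) → 1 ≤ x →
      InducedForest G (λ v → ρ ℓ v ≡ x))
theorem4p4 n G Δ≤3 =
  let ℓ , noWalk = search allOnes (<-wellFounded (potential allOnes))
  in ℓ , λ x _ c cycle inLevel → noWalk (cycle⇒monoWalk ℓ cycle (All.map (ρ-level ℓ) inLevel))
  where
  open LevelSets G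
  open MaxDegreeThree G Δ≤3
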